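{- Let $\mathcal S$ be a semifilter on $\omega$. Then $\mathcal S$ is co-meager (as a subset of $2^\omega$) if and only if $\mathcal S$ contains a semifilter that is a $G_\delta$ subset of $2^\omega$.
   Context: For $A,B\subseteq\omega$, $A\subseteq^* B$ means $A\setminus B$ is finite. A semifilter on $\omega$ is a set $\mathcal S\subseteq\mathcal P(\omega)$ with $\emptyset\neq\mathcal S\neq\mathcal P(\omega)$ that is closed upwards under $\subseteq^*$ (if $A\in\mathcal S$ and $A\subseteq^* B$ then $B\in\mathcal S$). Subsets of $\omega$ are identified with elements of the Cantor space $2^\omega$ via characteristic functions, and topological notions (open, $G_\delta$, meager, co-meager) refer to the product topology on $2^\omega$. -}

module Defs where

open import Data.Nat using (ℕ; _≤_; _<_)
open import Data.Bool using (Bool; true)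
open import Data.Product using (Σ; _×_; ∃)
open import Relation.Nullary using (¬_)
open import Relation.Binary.PropositionalEquality using (_≡_)

-- Points of Cantor space 2^ω = subsets of ω (via characteristic functions).
Cantor : Set
Cantor = ℕ → Bool

Family : Set₁
Family = Cantor → Set

_⊆*_ : Cantor → Cantor → Set
A ⊆* B = ∃ λ N → ∀ n → N ≤ n → A n ≡ true → B n ≡ true

IsSemifilter : Family → Set
IsSemifilter S =
  (∃ λ A → S A) × (¬ (∀ A → S A)) × (∀ A B → S A → A ⊆* B → S B)

Agree : ℕ → Cantor → Cantor → Set
Agree n x y = ∀ i → i < n → x i ≡ y i

IsOpen : Family → Set
IsOpen U = ∀ x → U x → ∃ λ n → ∀ y → Agree n x y → U y

IsDense : Family → Set
IsDense U = ∀ x n → ∃ λ y → Agree n x y × U y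

IsGδ : Family → Set₁
IsGδ G = Σ (ℕ → Family) λ U →
  (∀ k → IsOpen (U k)) × (∀ x → (G x → ∀ k → U k x) × ((∀ k → U k x) → G x))

IsComeager : Family → Set₁
IsComeager S = Σ (ℕ → Family) λ U →
  (∀ k → IsOpen (U k) × IsDense (U k)) × (∀ x → (∀ k → U k x) → S x)

_⊆F_ : Family → Family → Set
G ⊆F S = ∀ x → G x → S x

-- (⇐) A semifilter is dense: it contains some A, hence every cofinite
-- modification of A, hence a set extending any finite pattern.  So the open
-- sets of a G_δ representation of a semifilter G ⊆ S are dense and their
-- intersection G lies in S.
--
-- (⇒) Let S ⊇ ⋂ₖ Uₖ with Uₖ dense open.  A dense open V can be "forced on an
-- interval": for every a and every prescribed pattern on [a, e) there are
-- M ≥ e and q extending the pattern such that every y agreeing with q on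
-- [a, M) lies in V, whatever y does below a.  (Induction on a: handle the two
-- values of coordinate a one after the other.)  Forcing is preserved by finite
-- intersections, so U₀ ∩ … ∩ Uₙ can be forced as well.  Iterating with
-- a₀ = 0 gives consecutive blocks [aₙ, aₙ₊₁) and a set B such that B on block n
-- forces U₀ ∩ … ∩ Uₙ and B meets every block.  The family
--   G = { x : x ⊇ B on infinitely many blocks }
-- is a G_δ semifilter, and for x ∈ G the set x ∩ B lies in every Uₖ, hence in
-- S; as x ∩ B ⊆ x and S is upward closed, x ∈ S.
module Submission where

open import Defs
open import Data.Product using (Σ; _×_; _,_; proj₁; proj₂)
open import Data.Nat using (ℕ; zero; suc; _+_; _≤_; _<_; z≤n; s≤s; _≟_; _<?_)
open import Data.Nat.Properties
open import Data.Bool using (Bool; true; false; _∧_)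
open import Data.Sum using (inj₁; inj₂)
open import Data.Empty using (⊥-elim)
open import Relation.Nullary using (¬_; yes; no)
open import Relation.Binary using (tri<; tri≈; tri>)
open import Relation.Binary.PropositionalEquality using (_≡_; refl; sym; trans)

patch : ℕ → Cantor → Cantor
patch n x i with i <? n
... | yes _ = x i
... | no _ = true

patch-agrees : ∀ n x → Agree n x (patch n x)
patch-agrees n x i i<n with i <? n
... | yes _ = refl
... | no i≮n = ⊥-elim (i≮n i<n)

patch-cofinite : ∀ n x i → n ≤ i → patch n x i ≡ true
patch-cofinite n x i n≤i with i <? n
... | yes i<n = ⊥-elim (<⇒≱ i<n n≤i)
... | no _ = refl

-- A semifilter is dense: it contains patch n x ⊇* A for any of its members A.
semifilter-dense : ∀ {G} → IsSemifilter G → IsDense G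
semifilter-dense ((A , GA) , _ , upward) x n = patch n x , patch-agrees n x ,
  upward A (patch n x) GA (n , λ i n≤i _ → patch-cofinite n x i n≤i)

dense-mono : ∀ {V W} → V ⊆F W → IsDense V → IsDense W
dense-mono V⊆W dense-V x n with dense-V x n
... | y , x≈y , Vy = y , x≈y , V⊆W y Vy

-- A G_δ semifilter is co-meager: the open sets representing it contain it,
-- hence are dense.
Gδ-semifilter-comeager : ∀ {G} → IsSemifilter G → IsGδ G → IsComeager G
Gδ-semifilter-comeager semi (W , W-open , G⇔⋂W) =
  W , (λ k → W-open k , dense-mono (λ x Gx → proj₁ (G⇔⋂W x) Gx k) (semifilter-dense semi)) ,
  λ x ⋂W → proj₂ (G⇔⋂W x) ⋂W

comeager-mono : ∀ {G S} → G ⊆F S → IsComeager G → IsComeager S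
comeager-mono G⊆S (U , hU , ⋂U⊆G) = U , hU , λ x ⋂U → G⊆S x (⋂U⊆G x ⋂U)

AgreeOn : ℕ → ℕ → Cantor → Cantor → Set
AgreeOn a M f g = ∀ i → a ≤ i → i < M → f i ≡ g i

agree-trans : ∀ {a M f g h} → AgreeOn a M f g → AgreeOn a M g h → AgreeOn a M f h
agree-trans h₁ h₂ i a≤i i<M = trans (h₁ i a≤i i<M) (h₂ i a≤i i<M)

agree-shrink : ∀ {a a′ M M′ f g} → a ≤ a′ → M′ ≤ M →
  AgreeOn a M f g → AgreeOn a′ M′ f g
agree-shrink a≤a′ M′≤M h i a′≤i i<M′ = h i (≤-trans a≤a′ a′≤i) (<-≤-trans i<M′ M′≤M)

agree-extend : ∀ {a M f g} → f a ≡ g a → AgreeOn (suc a) M f g → AgreeOn a M f g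
agree-extend fa≡ga h i a≤i i<M with m≤n⇒m<n∨m≡n a≤i
... | inj₁ a<i = h i a<i i<M
... | inj₂ refl = fa≡ga

update : Cantor → ℕ → Bool → Cantor
update f a b i with i ≟ a
... | yes _ = b
... | no _ = f i

update-at : ∀ f a b → update f a b a ≡ b
update-at f a b with a ≟ a
... | yes _ = refl
... | no a≢a = ⊥-elim (a≢a refl)

update-above : ∀ f a b {M} → AgreeOn (suc a) M (update f a b) f
update-above f a b i a<i _ with i ≟ a
... | yes refl = ⊥-elim (<-irrefl refl a<i)
... | no _ = refl

Forces : ℕ → ℕ → Cantor → Family → Set
Forces a M q V = ∀ y → AgreeOn a M y q → V y

record Extension (V : Family) (a e : ℕ) (p : Cantor) : Set where
  constructor extension
  field
    end      : ℕ
    template : Cantor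
    e≤end    : e ≤ end
    agrees   : AgreeOn a e template p
    forces   : Forces a end template V
open Extension

Forceable : Family → Set
Forceable V = ∀ a e p → a ≤ e → Extension V a e p

forceable-mono : ∀ {V W} → V ⊆F W → Forceable V → Forceable W
forceable-mono V⊆W fV a e p a≤e = extension (end E) (template E) (e≤end E) (agrees E)
    (λ y agr → V⊆W y (forces E y agr))
  where
  E = fV a e p a≤e

-- With a = 0 this is density plus
-- openness; coordinate a is handled by forcing V first for the prefixes
-- with bit a = false and then, continuing that pattern, for bit a = true.
dense-open-forceable : ∀ {V} → IsOpen V → IsDense V → Forceable V
dense-open-forceable {V} open-V dense-V = go
  where
  go : Forceable V
  go zero e p _ with dense-V p e
  ... | y₀ , p≈y₀ , Vy₀ with open-V y₀ Vy₀
  ... | m , nbhd = extension (e + m) y₀ (m≤m+n e m)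
      (λ i _ i<e → sym (p≈y₀ i i<e))
      (λ y y≈y₀ → nbhd y (λ i i<m → sym (y≈y₀ i z≤n (<-≤-trans i<m (m≤n+m m e)))))
  go (suc a) e p a<e = extension (end E₁) (template E₁)
      (≤-trans (e≤end E₀) (e≤end E₁)) agrees-p forces-V
    where
    a≤e = <⇒≤ a<e
    E₀ = go a e (update p a false) a≤e
    E₁ = go a (end E₀) (update (template E₀) a true) (≤-trans a≤e (e≤end E₀))
    q₀ = template E₀
    q₁ = template E₁
    a<end₀ : a < end E₀
    a<end₀ = <-≤-trans a<e (e≤end E₀)
    q₀-at-a : q₀ a ≡ false
    q₀-at-a = trans (agrees E₀ a ≤-refl a<e) (update-at p a false)
    q₁-at-a : q₁ a ≡ true
    q₁-at-a = trans (agrees E₁ a ≤-refl a<end₀) (update-at q₀ a true)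
    q₁≈q₀ : AgreeOn (suc a) (end E₀) q₁ q₀
    q₁≈q₀ = agree-trans (agree-shrink (n≤1+n a) ≤-refl (agrees E₁)) (update-above q₀ a true)
    agrees-p : AgreeOn (suc a) e q₁ p
    agrees-p = agree-trans (agree-shrink ≤-refl (e≤end E₀) q₁≈q₀)
      (agree-trans (agree-shrink (n≤1+n a) ≤-refl (agrees E₀)) (update-above p a false))
    forces-V : Forces (suc a) (end E₁) q₁ V
    forces-V y y≈q₁ with y a in ya
    ... | true = forces E₁ y (agree-extend (trans ya (sym q₁-at-a)) y≈q₁)
    ... | false = forces E₀ y (agree-extend (trans ya (sym q₀-at-a))
      (agree-trans (agree-shrink ≤-refl (e≤end E₁) y≈q₁) q₁≈q₀))

-- Forceable sets are closed under binary intersection: force one, then the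
-- other on a longer interval continuing the first pattern.
_∩F_ : Family → Family → Family
(V ∩F W) y = V y × W y

forceable-∩ : ∀ {V W} → Forceable V → Forceable W → Forceable (V ∩F W)
forceable-∩ fV fW a e p a≤e = extension (end E₁) (template E₁)
    (≤-trans (e≤end E₀) (e≤end E₁))
    (agree-trans (agree-shrink ≤-refl (e≤end E₀) (agrees E₁)) (agrees E₀))
    (λ y y≈q₁ → forces E₀ y (agree-trans (agree-shrink ≤-refl (e≤end E₁) y≈q₁) (agrees E₁))
              , forces E₁ y y≈q₁)
  where
  E₀ = fV a e p a≤e
  E₁ = fW a (end E₀) (template E₀) (≤-trans a≤e (e≤end E₀))

Upto : (ℕ → Family) → ℕ → Family
Upto U n y = ∀ k → k ≤ n → U k y

forceable-upto : ∀ {U} → (∀ k → Forceable (U k)) → ∀ n → Forceable (Upto U n)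
forceable-upto {U} fU zero = forceable-mono (λ y U₀y → λ { zero _ → U₀y }) (fU zero)
forceable-upto {U} fU (suc n) =
  forceable-mono step (forceable-∩ (forceable-upto fU n) (fU (suc n)))
  where
  step : (Upto U n ∩F U (suc n)) ⊆F Upto U (suc n)
  step y (below , top) k k≤1+n with m≤n⇒m<n∨m≡n k≤1+n
  ... | inj₁ (s≤s k≤n) = below k k≤n
  ... | inj₂ refl = top

_∩_ : Cantor → Cantor → Cantor
(x ∩ y) i = x i ∧ y i

∩-⊆ˡ : ∀ x y i → (x ∩ y) i ≡ true → x i ≡ true
∩-⊆ˡ x y i with x i
... | true = λ _ → refl
... | false = λ ()

∩-absorb : ∀ x y i → (y i ≡ true → x i ≡ true) → (x ∩ y) i ≡ y i
∩-absorb x y i y⊆x with x i | y i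
... | true | _ = refl
... | false | false = refl
... | false | true = y⊆x refl

module Blocks (U : ℕ → Family) (forceable : ∀ n → Forceable (Upto U n)) where

  nextBlock : ∀ n a → Extension (Upto U n) a (suc a) (λ _ → true)
  nextBlock n a = forceable n a (suc a) (λ _ → true) (n≤1+n a)

  start : ℕ → ℕ
  start zero = 0
  start (suc n) = end (nextBlock n (start n))

  blockPattern : ℕ → Cantor
  blockPattern n = template (nextBlock n (start n))

  start-step : ∀ n → start n < start (suc n)
  start-step n = e≤end (nextBlock n (start n))

  start-mono : ∀ {m n} → m ≤ n → start m ≤ start n
  start-mono {n = zero} z≤n = ≤-refl
  start-mono {n = suc n} m≤1+n with m≤n⇒m<n∨m≡n m≤1+n
  ... | inj₁ (s≤s m≤n) = ≤-trans (start-mono m≤n) (<⇒≤ (start-step n))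
  ... | inj₂ refl = ≤-refl

  n≤start : ∀ n → n ≤ start n
  n≤start zero = z≤n
  n≤start (suc n) = ≤-trans (s≤s (n≤start n)) (start-step n)

  blockPattern-start : ∀ n → blockPattern n (start n) ≡ true
  blockPattern-start n = agrees (nextBlock n (start n)) (start n) ≤-refl ≤-refl

  blockPattern-forces : ∀ n → Forces (start n) (start (suc n)) (blockPattern n) (Upto U n)
  blockPattern-forces n = forces (nextBlock n (start n))

  InBlock : ℕ → ℕ → Set
  InBlock n i = start n ≤ i × i < start (suc n)

  blockOf : ℕ → ℕ
  blockOf zero = 0
  blockOf (suc i) with suc i <? start (suc (blockOf i))
  ... | yes _ = blockOf i
  ... | no _ = suc (blockOf i)

  blockOf-spec : ∀ i → InBlock (blockOf i) i
  blockOf-spec zero = z≤n , start-step 0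
  blockOf-spec (suc i) with suc i <? start (suc (blockOf i))
  ... | yes inside = ≤-trans (proj₁ (blockOf-spec i)) (n≤1+n i) , inside
  ... | no outside = ≮⇒≥ outside ,
      ≤-<-trans (proj₂ (blockOf-spec i)) (start-step (suc (blockOf i)))

  inBlock-unique : ∀ {m n i} → InBlock m i → InBlock n i → m ≡ n
  inBlock-unique {m} {n} (m≤i , i<m′) (n≤i , i<n′) with <-cmp m n
  ... | tri< m<n _ _ = ⊥-elim (<⇒≱ i<m′ (≤-trans (start-mono m<n) n≤i))
  ... | tri≈ _ m≡n _ = m≡n
  ... | tri> _ _ n<m = ⊥-elim (<⇒≱ i<n′ (≤-trans (start-mono n<m) m≤i))

  B : Cantor
  B i = blockPattern (blockOf i) i

  B-block : ∀ {n i} → InBlock n i → B i ≡ blockPattern n i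
  B-block {n} {i} i∈n with inBlock-unique (blockOf-spec i) i∈n
  ... | refl = refl

  Covers : ℕ → Cantor → Set
  Covers n x = ∀ i → InBlock n i → B i ≡ true → x i ≡ true

  CoversBeyond : ℕ → Family
  CoversBeyond j x = Σ ℕ λ n → j ≤ n × Covers n x

  G : Family
  G x = ∀ j → CoversBeyond j x

  -- Covering a block depends only on the coordinates below its end.
  coversBeyond-open : ∀ j → IsOpen (CoversBeyond j)
  coversBeyond-open j x (n , j≤n , covers) = start (suc n) , λ y x≈y →
    n , j≤n , λ i i∈n Bi → trans (sym (x≈y i (proj₂ i∈n))) (covers i i∈n Bi)

  G-Gδ : IsGδ G
  G-Gδ = CoversBeyond , coversBeyond-open , λ x → (λ Gx → Gx) , (λ Gx → Gx)

  -- ∅ ∉ G since B meets every block, and G is closed under ⊆* since a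
  -- finite difference only affects finitely many blocks.
  G-semifilter : IsSemifilter G
  G-semifilter = ((λ _ → true) , λ j → j , ≤-refl , λ _ _ _ → refl) , ∅∉G , upward
    where
    ∅∉G : ¬ (∀ x → G x)
    ∅∉G allG with allG (λ _ → false) 0
    ... | n , _ , covers
      with covers (start n) (≤-refl , start-step n)
             (trans (B-block (≤-refl , start-step n)) (blockPattern-start n))
    ... | ()
    upward : ∀ x z → G x → x ⊆* z → G z
    upward x z Gx (N , x⊆z) j with Gx (j + N)
    ... | n , j+N≤n , covers = n , ≤-trans (m≤m+n j N) j+N≤n , λ i i∈n Bi →
      x⊆z i (≤-trans (m≤n+m N j) (≤-trans j+N≤n (≤-trans (n≤start n) (proj₁ i∈n))))
        (covers i i∈n Bi)

  -- If x ∈ G then x ∩ B lies in every Uₖ: choose a block n ≥ k covered by x;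
  -- there x ∩ B equals B, i.e. the pattern forcing U₀ ∩ … ∩ Uₙ.
  G-meet-B : ∀ x → G x → ∀ k → U k (x ∩ B)
  G-meet-B x Gx k with Gx k
  ... | n , k≤n , covers = blockPattern-forces n (x ∩ B)
      (λ i n≤i i<n′ → trans (∩-absorb x B i (covers i (n≤i , i<n′)))
                            (B-block (n≤i , i<n′)))
      k k≤n

comeager⇒Gδ-semifilter : ∀ {S} → (∀ A B → S A → A ⊆* B → S B) → IsComeager S →
  Σ Family λ G → IsSemifilter G × IsGδ G × G ⊆F S
comeager⇒Gδ-semifilter upward (U , hU , ⋂U⊆S) = G , G-semifilter , G-Gδ ,
    λ x Gx → upward (x ∩ B) x (⋂U⊆S (x ∩ B) (G-meet-B x Gx)) (0 , λ i _ → ∩-⊆ˡ x B i)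
  where
  open Blocks U (forceable-upto (λ k → dense-open-forceable (proj₁ (hU k)) (proj₂ (hU k))))

corollary2p3 : (S : Family) → IsSemifilter S →
    (IsComeager S → Σ Family λ G → IsSemifilter G × IsGδ G × G ⊆F S)
    × ((Σ Family λ G → IsSemifilter G × IsGδ G × G ⊆F S) → IsComeager S)
corollary2p3 S (_ , _ , upward) =
  comeager⇒Gδ-semifilter upward ,
  λ (G , G-semi , G-Gδ , G⊆S) → comeager-mono G⊆S (Gδ-semifilter-comeager G-semi G-Gδ)
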